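{- Let $\mathbb{M}$ be a monster model of $T_{\log}$ with underlying set $\Gamma\cup\{\infty\}$, let $I$ be an infinite ordered index set, and let $(a_i)_{i\in I}$ be a strictly increasing indiscernible sequence from $\Gamma$. Suppose $b_0,b_1\in\Gamma$ are such that $(a_i)_{i\in I}$ is spread out by both $b_0$ and $b_1$. Then for every $i<j$ in $I$, \[ps(a_i-b_0)=ps(a_i-b_1)=p\psi(a_i-a_j).\]
   Context: $\mathcal{L}_{\log}=\{0,+,-,<,\psi,\infty,s,p,\delta_1,\delta_2,\ldots\}$. An asymptotic couple is $(\Gamma,\psi)$ with $\Gamma$ an ordered abelian group, $\psi:\Gamma\setminus\{0\}\to\Gamma$ with, for nonzero $\alpha,\beta$: $\alpha+\beta\ne0\Rightarrow\psi(\alpha+\beta)\ge\min(\psi(\alpha),\psi(\beta))$; $\psi(k\alpha)=\psi(\alpha)$ for nonzero integers $k$; $\alpha>0\Rightarrow\alpha+\psi(\alpha)>\psi(\beta)$; $H$-type: $0<\alpha\le\beta\Rightarrow\psi(\alpha)\ge\psi(\beta)$. $\psi(0)=\infty$, $\Psi=\psi(\Gamma\setminus\{0\})$, $\alpha'=\alpha+\psi(\alpha)$; asymptotic integration: each $\gamma$ equals $\alpha'$ for a unique $\alpha\neq0$, written $\int\gamma$; $s(\gamma)=\psi(\int\gamma)$. Models of $T_{\log}$: divisible $H$-asymptotic couples with asymptotic integration such that $\Psi$ has least element $s(0)>0$, each $\alpha\in\Psi$ has immediate successor $s(\alpha)$ in $\Psi$, and $s:\Psi\to\Psi^{>s(0)}$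 is a bijection; $p$ is its inverse on $\Psi^{>s(0)}$ and $\infty$ elsewhere; underlying set $\Gamma\cup\{\infty\}$, $\Gamma<\infty$, $\delta_n$ division by $n$, $\infty$ default value of all functions. Indiscernibility is in $\mathcal{L}_{\log}$. For $a,b\in\operatorname{conv}(\Psi)$ (convex hull of $\Psi$ in $\Gamma$) write $a\ll b$ if $s^n(a)<b$ for every $n\in\mathbb{N}$. The sequence $(a_i)_{i\in I}$ is spread out by $b\in\Gamma$ if $a_i-b\in\operatorname{conv}(\Psi)$ for all $i$ and $s(0)\ll a_i-b\ll a_j-b$ for all $i<j$. -}

module Defs where

open import Level using (0ℓ)
open import Data.Nat using (ℕ; zero; suc)
open import Data.Integer using (ℤ; +_; -[1+_])
open import Data.Fin using (Fin) renaming (_<_ to _<F_)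
open import Data.Product using (Σ; ∃; _×_; _,_)
open import Data.Sum using (_⊎_)
open import Data.Unit using (⊤)
open import Data.Empty using (⊥)
open import Function using (_∘_; Injective)
open import Relation.Nullary using (¬_)
open import Relation.Binary.PropositionalEquality using (_≡_; _≢_)
open import Relation.Binary.Structures using (IsStrictTotalOrder)
open import Algebra.Structures using (IsAbelianGroup)

data Ext (Γ : Set) : Set where
  fin : Γ → Ext Γ
  ∞   : Ext Γ

mulN : {A : Set} → (A → A → A) → A → ℕ → A → A
mulN _+_ e zero    x = e
mulN _+_ e (suc n) x = x + mulN _+_ e n x

mulZ : {A : Set} → (A → A → A) → A → (A → A) → ℤ → A → A
mulZ _+_ e neg (+ n)    x = mulN _+_ e n x
mulZ _+_ e neg -[1+ n ] x = neg (mulN _+_ e (suc n) x)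

-- Models of T_log, described as L_log-structures on Γ ∪ {∞}.
-- ψ : Γ → Γ ∪ {∞}  with ψ 0 = ∞ and ψ α ∈ Γ for α ≠ 0.
-- ∫ : asymptotic integration, s γ := ψ (∫ γ), p as given by the axioms.
-- div k : division by (suc k), i.e. δ_{k+1}.

record TlogModel : Set₁ where
  infix 4 _<_ _≤_
  infixl 6 _+_
  field
    Γ     : Set
    _+_   : Γ → Γ → Γ
    0g    : Γ
    -_    : Γ → Γ
    _<_   : Γ → Γ → Set
    ψ     : Γ → Ext Γ
    ∫     : Γ → Γ
    pfun  : Γ → Ext Γ
    div   : ℕ → Γ → Γ

  _≤_ : Γ → Γ → Set
  x ≤ y = (x < y) ⊎ (x ≡ y)

  mulℕ : ℕ → Γ → Γ
  mulℕ = mulN _+_ 0g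

  mulℤ : ℤ → Γ → Γ
  mulℤ = mulZ _+_ 0g -_

  InΨ : Γ → Set
  InΨ x = Σ Γ λ α → ψ α ≡ fin x

  IsDeriv : Γ → Γ → Set
  IsDeriv α γ = Σ Γ λ δ → (ψ α ≡ fin δ) × (α + δ ≡ γ)

  field
    isAbelianGroup : IsAbelianGroup _≡_ _+_ 0g -_
    isStrictTotalOrder : IsStrictTotalOrder _≡_ _<_
    <-compat : ∀ x y z → x < y → x + z < y + z
    -- divisibility, δ_{k+1} = division by k+1
    div-spec : ∀ k α → mulℕ (suc k) (div k α) ≡ α
    ψ-zero    : ψ 0g ≡ ∞
    ψ-nonzero : ∀ α → α ≢ 0g → Σ Γ λ γ → ψ α ≡ fin γ
    ψ-add     : ∀ α β γ δ ε → α ≢ 0g → β ≢ 0g → (α + β) ≢ 0g →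
                ψ α ≡ fin γ → ψ β ≡ fin δ → ψ (α + β) ≡ fin ε →
                (γ ≤ ε) ⊎ (δ ≤ ε)
    ψ-mul     : ∀ (k : ℤ) α → k ≢ + 0 → α ≢ 0g → ψ (mulℤ k α) ≡ ψ α
    ψ-pos     : ∀ α β γ δ → 0g < α → β ≢ 0g →
                ψ α ≡ fin γ → ψ β ≡ fin δ → δ < α + γ
    ψ-H       : ∀ α β γ δ → 0g < α → α ≤ β →
                ψ α ≡ fin γ → ψ β ≡ fin δ → δ ≤ γ
    ∫-nonzero : ∀ γ → ∫ γ ≢ 0g
    ∫-deriv   : ∀ γ → IsDeriv (∫ γ) γ
    ∫-unique  : ∀ α γ → α ≢ 0g → IsDeriv α γ → α ≡ ∫ γ

  s : Γ → Ext Γ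
  s γ = ψ (∫ γ)

  field
    s0        : Γ
    s0-def    : s 0g ≡ fin s0
    s0-pos    : 0g < s0
    s0-least  : ∀ x → InΨ x → s0 ≤ x
    s-succ    : ∀ x y → InΨ x → s x ≡ fin y → x < y
    s-imm     : ∀ x y z → InΨ x → s x ≡ fin y → InΨ z → x < z → ¬ (z < y)
    -- s : Ψ → Ψ^{>s(0)} is onto (injectivity follows from the above)
    s-onto    : ∀ y → InΨ y → s0 < y → Σ Γ λ x → InΨ x × (s x ≡ fin y)
    p-def     : ∀ y → InΨ y → s0 < y →
                Σ Γ λ x → InΨ x × (s x ≡ fin y) × (pfun y ≡ fin x)
    p-undef   : ∀ y → ¬ (InΨ y × (s0 < y)) → pfun y ≡ ∞

  _+∞_ : Ext Γ → Ext Γ → Ext Γ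
  fin x +∞ fin y = fin (x + y)
  _     +∞ _     = ∞

  -∞ : Ext Γ → Ext Γ
  -∞ (fin x) = fin (- x)
  -∞ ∞       = ∞

  ψ∞ : Ext Γ → Ext Γ
  ψ∞ (fin x) = ψ x
  ψ∞ ∞       = ∞

  s∞ : Ext Γ → Ext Γ
  s∞ (fin x) = s x
  s∞ ∞       = ∞

  p∞ : Ext Γ → Ext Γ
  p∞ (fin x) = pfun x
  p∞ ∞       = ∞

  δ∞ : ℕ → Ext Γ → Ext Γ
  δ∞ k (fin x) = fin (div k x)
  δ∞ k ∞       = ∞

  _<∞_ : Ext Γ → Ext Γ → Set
  fin x <∞ fin y = x < y
  fin x <∞ ∞     = ⊤
  ∞     <∞ _     = ⊥

  iter : ℕ → (Ext Γ → Ext Γ) → Ext Γ → Ext Γ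
  iter zero    f x = x
  iter (suc n) f x = f (iter n f x)

  InConvΨ : Γ → Set
  InConvΨ x = Σ Γ λ y → Σ Γ λ z → InΨ y × InΨ z × (y ≤ x) × (x ≤ z)

  _≪_ : Γ → Γ → Set
  a ≪ b = ∀ (n : ℕ) → iter n s∞ (fin a) <∞ fin b

data Term (n : ℕ) : Set where
  var   : Fin n → Term n
  zeroT : Term n
  infT  : Term n
  plusT : Term n → Term n → Term n
  negT  : Term n → Term n
  psiT  : Term n → Term n
  sT    : Term n → Term n
  pT    : Term n → Term n
  deltaT : ℕ → Term n → Term n   -- deltaT k = δ_{k+1}

data Formula : ℕ → Set where
  eqF  : ∀ {n} → Term n → Term n → Formula n
  ltF  : ∀ {n} → Term n → Term n → Formula n
  notF : ∀ {n} → Formula n → Formula n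
  andF : ∀ {n} → Formula n → Formula n → Formula n
  exF  : ∀ {n} → Formula (suc n) → Formula n

module Semantics (M : TlogModel) where
  open TlogModel M

  cons : ∀ {n} → Ext Γ → (Fin n → Ext Γ) → Fin (suc n) → Ext Γ
  cons x ρ Fin.zero    = x
  cons x ρ (Fin.suc i) = ρ i

  evalT : ∀ {n} → Term n → (Fin n → Ext Γ) → Ext Γ
  evalT (var i)      ρ = ρ i
  evalT zeroT        ρ = fin 0g
  evalT infT         ρ = ∞
  evalT (plusT t u)  ρ = evalT t ρ +∞ evalT u ρ
  evalT (negT t)     ρ = -∞ (evalT t ρ)
  evalT (psiT t)     ρ = ψ∞ (evalT t ρ)
  evalT (sT t)       ρ = s∞ (evalT t ρ)
  evalT (pT t)       ρ = p∞ (evalT t ρ)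
  evalT (deltaT k t) ρ = δ∞ k (evalT t ρ)

  Sat : ∀ {n} → Formula n → (Fin n → Ext Γ) → Set
  Sat (eqF t u)  ρ = evalT t ρ ≡ evalT u ρ
  Sat (ltF t u)  ρ = evalT t ρ <∞ evalT u ρ
  Sat (notF φ)   ρ = ¬ Sat φ ρ
  Sat (andF φ ψ) ρ = Sat φ ρ × Sat ψ ρ
  Sat (exF φ)    ρ = Σ (Ext Γ) λ x → Sat φ (cons x ρ)

record InfiniteOrder : Set₁ where
  field
    I      : Set
    _<I_   : I → I → Set
    isSTO  : IsStrictTotalOrder _≡_ _<I_
    embed  : ℕ → I
    embed-inj : Injective _≡_ _≡_ embed

module Sequences (M : TlogModel) (O : InfiniteOrder) where
  open TlogModel M
  open InfiniteOrder O
  open Semantics M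

  StrictlyIncreasingTuple : ∀ {n} → (Fin n → I) → Set
  StrictlyIncreasingTuple {n} f = ∀ (k l : Fin n) → k <F l → f k <I f l

  Indiscernible : (I → Γ) → Set
  Indiscernible a = ∀ (n : ℕ) (φ : Formula n) (f g : Fin n → I) →
    StrictlyIncreasingTuple f → StrictlyIncreasingTuple g →
    (Sat φ (fin ∘ a ∘ f) → Sat φ (fin ∘ a ∘ g)) ×
    (Sat φ (fin ∘ a ∘ g) → Sat φ (fin ∘ a ∘ f))

  StrictlyIncreasing : (I → Γ) → Set
  StrictlyIncreasing a = ∀ i j → i <I j → a i < a j

  SpreadOutBy : (I → Γ) → Γ → Set
  SpreadOutBy a b =
    (∀ i → InConvΨ (a i + - b)) ×
    (∀ i j → i <I j → (s0 ≪ (a i + - b)) × ((a i + - b) ≪ (a j + - b)))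

module Submission where

-- Put X = aᵢ − b and Y = aⱼ − b, so that X − Y = aᵢ − aⱼ does not depend on b.
-- With u = ∫ X we have X = u + s(X), and s(X) < Y since X ≪ Y. As Y lies below
-- an element of Ψ, ∫ Y < 0 and so Y < s(Y); splitting
-- Y − s(X) = ∫ Y + (s(Y) − s(X)) then gives ψ(Y − s(X)) > s(X). Hence in
-- X − Y = u − (Y − s(X)) the summand u has the strictly smaller ψ-value, and
-- ψ(aᵢ − aⱼ) = ψ(u) = s(X).

open import Defs
open import Level using (0ℓ)
open import Data.Product using (_×_; _,_; proj₁; proj₂)
open import Data.Sum using (inj₁; inj₂; [_,_]′)
open import Data.Integer using (-[1+_])
open import Data.Empty using (⊥-elim)
open import Relation.Nullary using (¬_)
open import Relation.Binary.Definitions using (Tri; tri<; tri≈; tri>)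
open import Relation.Binary.PropositionalEquality
open import Relation.Binary.Structures using (IsStrictTotalOrder)
open import Algebra.Bundles using (AbelianGroup)
import Algebra.Properties.AbelianGroup as AbelianGroupProperties
import Relation.Binary.Construct.StrictToNonStrict as StrictToNonStrict

module AsymptoticCouple (M : TlogModel) where
  open TlogModel M

  additiveGroup : AbelianGroup 0ℓ 0ℓ
  additiveGroup = record { isAbelianGroup = isAbelianGroup }

  open AbelianGroup additiveGroup using (assoc; comm; identityˡ; identityʳ; inverseʳ)
  open AbelianGroupProperties additiveGroup
    using (inverseʳ-unique; ⁻¹-involutive; ε⁻¹≈ε; ⁻¹-anti-homo‿-; \\-leftDividesʳ; //-rightDividesˡ; xyx⁻¹≈y)
  open IsStrictTotalOrder isStrictTotalOrder using (compare; irrefl; <-respʳ-≈) renaming (trans to <-trans)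
  open ≡-Reasoning

  <-irrefl : ∀ {x} → ¬ (x < x)
  <-irrefl = irrefl refl

  ≤⇒≯ : ∀ {x y} → x ≤ y → ¬ (y < x)
  ≤⇒≯ (inj₁ x<y) y<x = <-irrefl (<-trans x<y y<x)
  ≤⇒≯ (inj₂ refl) x<x = <-irrefl x<x

  <-≤-trans : ∀ {x y z} → x < y → y ≤ z → x < z
  <-≤-trans = StrictToNonStrict.<-≤-trans _≡_ _<_ <-trans <-respʳ-≈

  <⇒≢ : ∀ {x y} → x < y → y ≢ x
  <⇒≢ x<y refl = <-irrefl x<y

  x<y⇒0<y-x : ∀ {x y} → x < y → 0g < y + - x
  x<y⇒0<y-x {x} {y} x<y = subst (_< y + - x) (inverseʳ x) (<-compat x y (- x) x<y)

  x<y⇒y-x≢0 : ∀ {x y} → x < y → y + - x ≢ 0g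
  x<y⇒y-x≢0 x<y = <⇒≢ (x<y⇒0<y-x x<y)

  x<y+z⇒x-y<z : ∀ {x y z} → x < y + z → x + - y < z
  x<y+z⇒x-y<z {x} {y} {z} x<y+z = subst (x + - y <_) (xyx⁻¹≈y y z) (<-compat x (y + z) (- y) x<y+z)

  x-[x-y]≡y : ∀ x y → x + - (x + - y) ≡ y
  x-[x-y]≡y x y = begin
    x + - (x + - y)  ≡⟨ cong (x +_) (⁻¹-anti-homo‿- x y) ⟩
    x + (y + - x)    ≡⟨ comm x (y + - x) ⟩
    (y + - x) + x    ≡⟨ //-rightDividesˡ x y ⟩
    y                ∎

  [x-z]-[y-z]≡x-y : ∀ x y z → (x + - z) + - (y + - z) ≡ x + - y
  [x-z]-[y-z]≡x-y x y z = begin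
    (x + - z) + - (y + - z)  ≡⟨ cong ((x + - z) +_) (⁻¹-anti-homo‿- y z) ⟩
    (x + - z) + (z + - y)    ≡⟨ assoc x (- z) (z + - y) ⟩
    x + (- z + (z + - y))    ≡⟨ cong (x +_) (\\-leftDividesʳ z (- y)) ⟩
    x + - y                  ∎

  ψ≡fin⇒≢0 : ∀ {α δ} → ψ α ≡ fin δ → α ≢ 0g
  ψ≡fin⇒≢0 ψα≡δ refl with trans (sym ψ-zero) ψα≡δ
  ... | ()

  fin-injective : ∀ {x y : Γ} → fin x ≡ fin y → x ≡ y
  fin-injective refl = refl

  neg-≢0 : ∀ {α} → α ≢ 0g → - α ≢ 0g
  neg-≢0 {α} α≢0 -α≡0 = α≢0 (begin
    α        ≡⟨ sym (⁻¹-involutive α) ⟩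
    - (- α)  ≡⟨ cong -_ -α≡0 ⟩
    - 0g     ≡⟨ ε⁻¹≈ε ⟩
    0g       ∎)

  ψ-neg : ∀ α → α ≢ 0g → ψ (- α) ≡ ψ α
  ψ-neg α α≢0 = subst (λ β → ψ (- β) ≡ ψ α) (identityʳ α) (ψ-mul -[1+ 0 ] α (λ ()) α≢0)

  ψ-+-lowerBound : ∀ {c p q P Q R} → ψ p ≡ fin P → ψ q ≡ fin Q → ψ (p + q) ≡ fin R →
                   c < P → c < Q → c < R
  ψ-+-lowerBound ψp ψq ψp+q c<P c<Q
    with ψ-add _ _ _ _ _ (ψ≡fin⇒≢0 ψp) (ψ≡fin⇒≢0 ψq) (ψ≡fin⇒≢0 ψp+q) ψp ψq ψp+q
  ... | inj₁ P≤R = <-≤-trans c<P P≤R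
  ... | inj₂ Q≤R = <-≤-trans c<Q Q≤R

  ψ-+-dominant : ∀ {p q P Q} → ψ p ≡ fin P → ψ q ≡ fin Q → Q < P → ψ (p + q) ≡ fin Q
  ψ-+-dominant {p} {q} {P} {Q} ψp ψq Q<P = trans ψp+q (cong fin (R≡Q (compare R Q)))
    where
    p≢0 : p ≢ 0g
    p≢0 = ψ≡fin⇒≢0 ψp
    q≢0 : q ≢ 0g
    q≢0 = ψ≡fin⇒≢0 ψq
    p+q≢0 : p + q ≢ 0g
    p+q≢0 p+q≡0 = <⇒≢ Q<P (fin-injective (begin
      fin P     ≡⟨ sym ψp ⟩
      ψ p       ≡⟨ sym (ψ-neg p p≢0) ⟩
      ψ (- p)   ≡⟨ cong ψ (sym (inverseʳ-unique p q p+q≡0)) ⟩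
      ψ q       ≡⟨ ψq ⟩
      fin Q     ∎))
    R : Γ
    R = proj₁ (ψ-nonzero (p + q) p+q≢0)
    ψp+q : ψ (p + q) ≡ fin R
    ψp+q = proj₂ (ψ-nonzero (p + q) p+q≢0)
    [p+q]-p≡q : (p + q) + - p ≡ q
    [p+q]-p≡q = xyx⁻¹≈y p q
    R≡Q : Tri (R < Q) (R ≡ Q) (Q < R) → R ≡ Q
    R≡Q (tri≈ _ R≡Q _) = R≡Q
    R≡Q (tri< R<Q _ _) = ⊥-elim ([ (λ P≤R → ≤⇒≯ P≤R (<-trans R<Q Q<P)) , (λ Q≤R → ≤⇒≯ Q≤R R<Q) ]′
      (ψ-add p q P Q R p≢0 q≢0 p+q≢0 ψp ψq ψp+q))
    R≡Q (tri> _ _ Q<R) = ⊥-elim ([ (λ R≤Q → ≤⇒≯ R≤Q Q<R) , (λ P≤Q → ≤⇒≯ P≤Q Q<P) ]′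
      (ψ-add (p + q) (- p) R P Q p+q≢0 (neg-≢0 p≢0) (subst (_≢ 0g) (sym [p+q]-p≡q) q≢0)
             ψp+q (trans (ψ-neg p p≢0) ψp) (trans (cong ψ [p+q]-p≡q) ψq)))

  γ<ψ[δ-γ] : ∀ {γ δ t} → InΨ δ → γ < δ → ψ (δ + - γ) ≡ fin t → γ < t
  γ<ψ[δ-γ] {γ} {δ} (β , ψβ) γ<δ ψ[δ-γ] =
    subst (_< _) (x-[x-y]≡y δ γ)
      (x<y+z⇒x-y<z (ψ-pos _ β _ δ (x<y⇒0<y-x γ<δ) (ψ≡fin⇒≢0 ψβ) ψ[δ-γ] ψβ))

  deriv-below-Ψ⇒<ψ : ∀ {v d z} → ψ v ≡ fin d → InΨ z → v + d ≤ z → v + d < d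
  deriv-below-Ψ⇒<ψ {v} {d} {z} ψv (α , ψα) v+d≤z =
    subst (v + d <_) (identityˡ d) (<-compat v 0g d (v<0 (compare v 0g)))
    where
    v<0 : Tri (v < 0g) (v ≡ 0g) (0g < v) → v < 0g
    v<0 (tri< v<0 _ _) = v<0
    v<0 (tri≈ _ v≡0 _) = ⊥-elim (ψ≡fin⇒≢0 ψv v≡0)
    v<0 (tri> _ _ 0<v) = ⊥-elim (≤⇒≯ v+d≤z (ψ-pos v α d z 0<v (ψ≡fin⇒≢0 ψα) ψv ψα))

  γ<ψ[Y-γ] : ∀ {γ Y z e} → InΨ z → Y ≤ z → γ < Y → ψ (Y + - γ) ≡ fin e → γ < e
  γ<ψ[Y-γ] {γ} {Y} {z} {e} Ψz Y≤z γ<Y ψ[Y-γ] with ∫-deriv Y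
  ... | d , ψv , v+d≡Y = ψ-+-lowerBound ψv ψθ ψ[v+θ] γ<d (γ<ψ[δ-γ] (∫ Y , ψv) γ<d ψθ)
    where
    Y<d : Y < d
    Y<d = subst (_< d) v+d≡Y (deriv-below-Ψ⇒<ψ ψv Ψz (subst (_≤ z) (sym v+d≡Y) Y≤z))
    γ<d : γ < d
    γ<d = <-trans γ<Y Y<d
    θ : Γ
    θ = d + - γ
    t : Γ
    t = proj₁ (ψ-nonzero θ (x<y⇒y-x≢0 γ<d))
    ψθ : ψ θ ≡ fin t
    ψθ = proj₂ (ψ-nonzero θ (x<y⇒y-x≢0 γ<d))
    ψ[v+θ] : ψ (∫ Y + θ) ≡ fin e
    ψ[v+θ] = begin
      ψ (∫ Y + (d + - γ))  ≡⟨ cong ψ (sym (assoc (∫ Y) d (- γ))) ⟩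
      ψ ((∫ Y + d) + - γ)  ≡⟨ cong (λ y → ψ (y + - γ)) v+d≡Y ⟩
      ψ (Y + - γ)          ≡⟨ ψ[Y-γ] ⟩
      fin e                ∎

  s≡ψ-sub : ∀ {X Y z} → InΨ z → Y ≤ z → s X <∞ fin Y → s X ≡ ψ (X + - Y)
  s≡ψ-sub {X} {Y} Ψz Y≤z sX<Y with ∫-deriv X
  ... | d , ψu , u+d≡X = trans ψu (sym (trans (cong ψ X-Y≡-x+u) ψ[-x+u]))
    where
    u : Γ
    u = ∫ X
    x : Γ
    x = Y + - d
    d<Y : d < Y
    d<Y = subst (_<∞ fin Y) ψu sX<Y
    e : Γ
    e = proj₁ (ψ-nonzero x (x<y⇒y-x≢0 d<Y))
    ψx : ψ x ≡ fin e
    ψx = proj₂ (ψ-nonzero x (x<y⇒y-x≢0 d<Y))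
    ψ[-x+u] : ψ (- x + u) ≡ fin d
    ψ[-x+u] = ψ-+-dominant (trans (ψ-neg x (x<y⇒y-x≢0 d<Y)) ψx) ψu (γ<ψ[Y-γ] Ψz Y≤z d<Y ψx)
    X-Y≡-x+u : X + - Y ≡ - x + u
    X-Y≡-x+u = begin
      X + - Y          ≡⟨ cong (_+ - Y) (sym u+d≡X) ⟩
      (u + d) + - Y    ≡⟨ assoc u d (- Y) ⟩
      u + (d + - Y)    ≡⟨ comm u (d + - Y) ⟩
      (d + - Y) + u    ≡⟨ cong (_+ u) (sym (⁻¹-anti-homo‿- Y d)) ⟩
      - (Y + - d) + u  ∎

lemma5p2 : (M : TlogModel) (O : InfiniteOrder) →
    let open TlogModel M
        open InfiniteOrder O
        open Sequences M O
    in (a : I → Γ) → StrictlyIncreasing a → Indiscernible a →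
       (b₀ b₁ : Γ) → SpreadOutBy a b₀ → SpreadOutBy a b₁ →
       ∀ i j → i <I j →
       (p∞ (s∞ (fin (a i + - b₀))) ≡ p∞ (s∞ (fin (a i + - b₁)))) ×
       (p∞ (s∞ (fin (a i + - b₁))) ≡ p∞ (ψ (a i + - a j)))
lemma5p2 M O a _ _ b₀ b₁ (inConv₀ , spread₀) (inConv₁ , spread₁) i j i<j =
  cong p∞ (trans s[aᵢ-b₀]≡ψ (sym s[aᵢ-b₁]≡ψ)) , cong p∞ s[aᵢ-b₁]≡ψ
  where
  open TlogModel M
  open AsymptoticCouple M
  s[aᵢ-b]≡ψ[aᵢ-aⱼ] : ∀ b → InConvΨ (a j + - b) → (a i + - b) ≪ (a j + - b) →
                     s (a i + - b) ≡ ψ (a i + - a j)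
  s[aᵢ-b]≡ψ[aᵢ-aⱼ] b (_ , _ , _ , Ψz , _ , aⱼ-b≤z) aᵢ-b≪aⱼ-b =
    trans (s≡ψ-sub Ψz aⱼ-b≤z (aᵢ-b≪aⱼ-b 1)) (cong ψ ([x-z]-[y-z]≡x-y (a i) (a j) b))
  s[aᵢ-b₀]≡ψ : s (a i + - b₀) ≡ ψ (a i + - a j)
  s[aᵢ-b₀]≡ψ = s[aᵢ-b]≡ψ[aᵢ-aⱼ] b₀ (inConv₀ j) (proj₂ (spread₀ i j i<j))
  s[aᵢ-b₁]≡ψ : s (a i + - b₁) ≡ ψ (a i + - a j)
  s[aᵢ-b₁]≡ψ = s[aᵢ-b]≡ψ[aᵢ-aⱼ] b₁ (inConv₁ j) (proj₂ (spread₁ i j i<j))
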